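{- Let $G$ be a $P_6$-free graph, $\Omega$ a potential maximal clique in $G$, and $D_1,D_2$ two connected components of $G-\Omega$. Then either $N(D_1)\setminus N(D_2)$ is complete to $V(D_1)$, or $N(D_2)\setminus N(D_1)$ is complete to $V(D_2)$. Furthermore, for all $v_1\in N(D_1)\setminus N(D_2)$ and $v_2\in N(D_2)\setminus N(D_1)$ with $v_1v_2\notin E(G)$, $v_1$ is complete to $V(D_1)$ and $v_2$ is complete to $V(D_2)$.
   Context: Graphs are finite and simple; $P_6$-free means no induced path on $6$ vertices. For a vertex set $D$, $N(D)$ is the set of vertices outside $D$ with a neighbour in $D$. A vertex $u$ is complete to a set $X$ if $u$ is adjacent to every vertex of $X$; a set $Y$ is complete to $X$ if each vertex of $Y$ is (vacuously true if $Y=\emptyset$). A set $\Omega\subseteq V(G)$ is a potential maximal clique if (PMC1) no connected component $D$ of $G-\Omega$ satisfies $N(D)=\Omega$, and (PMC2) for every two non-adjacent $u,v\in\Omega$ there is a component $D$ of $G-\Omega$ with $\{u,v\}\subseteq N(D)$. -}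

module Defs where

open import Data.Nat using (ℕ; suc)
open import Data.Bool using (Bool; true; false)
open import Data.Fin using (Fin; toℕ)
open import Data.Fin.Subset using (Subset; _∈_; _∉_)
open import Data.Product using (Σ; ∃; ∃-syntax; _×_; _,_)
open import Data.Sum using (_⊎_)
open import Relation.Nullary using (¬_)
open import Relation.Binary.PropositionalEquality using (_≡_; _≢_)
open import Function.Definitions using (Injective)

record Graph (n : ℕ) : Set where
  field
    adj   : Fin n → Fin n → Bool
    sym   : ∀ u v → adj u v ≡ adj v u
    irrefl : ∀ v → adj v v ≡ false
open Graph public

module _ {n : ℕ} (G : Graph n) where

  Adj : Fin n → Fin n → Set
  Adj u v = adj G u v ≡ true

  IsInducedP6 : (Fin 6 → Fin n) → Set
  IsInducedP6 p =
    Injective _≡_ _≡_ p ×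
    (∀ i j → (Adj (p i) (p j) → (suc (toℕ i) ≡ toℕ j ⊎ suc (toℕ j) ≡ toℕ i))
           × ((suc (toℕ i) ≡ toℕ j ⊎ suc (toℕ j) ≡ toℕ i) → Adj (p i) (p j)))

  P6Free : Set
  P6Free = ¬ (Σ (Fin 6 → Fin n) IsInducedP6)

  data WalkIn (S : Subset n) : Fin n → Fin n → Set where
    here : ∀ {x} → x ∈ S → WalkIn S x x
    step : ∀ {x y z} → x ∈ S → Adj x y → WalkIn S y z → WalkIn S x z

  IsComponentOf : (Ω D : Subset n) → Set
  IsComponentOf Ω D =
    (∃[ x ] x ∈ D) ×
    (∀ x → x ∈ D → x ∉ Ω) ×
    (∀ x y → x ∈ D → y ∈ D → WalkIn D x y) ×
    (∀ x y → x ∈ D → Adj x y → y ∉ Ω → y ∈ D)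

  InN : Subset n → Fin n → Set
  InN D v = v ∉ D × (∃[ x ] (x ∈ D × Adj v x))

  CompleteTo : Fin n → Subset n → Set
  CompleteTo u X = ∀ x → x ∈ X → Adj u x

  IsPMC : Subset n → Set
  IsPMC Ω =
    (∀ D → IsComponentOf Ω D → ¬ (∀ v → (InN D v → v ∈ Ω) × (v ∈ Ω → InN D v))) ×
    (∀ u v → u ∈ Ω → v ∈ Ω → u ≢ v → ¬ Adj u v →
       ∃[ D ] (IsComponentOf Ω D × InN D u × InN D v))

module Submission where

-- Every obstruction becomes an induced P₆ of one shape (noP4Away): if v ∈ N(X)
-- is not complete to the component X, a walk in X gives an edge a – b of X
-- with v ~ a, v ≁ b, and b – a – v glued to any induced path v – y₁ – y₂ – y₃
-- whose vertices have no neighbour in X is an induced P₆.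
--  * Second claim (privateComplete): for private neighbours v₁ ≁ v₂ of D₁, D₂,
--    (PMC2) gives a component D with v₁, v₂ ∈ N(D); connecting v₁ to v₂
--    through D (shortConnection) yields v₁ – d – v₂ – c with c ∈ D₂, or an
--    induced v₁ – d₁ – d₂ – v₂, or an induced v₁ – d₁ – d₂ – d₃ inside D.
--  * First claim (noTwoIncompletePrivates): two incomplete private neighbours
--    are adjacent by the second claim, and v₁ – v₂ – c – e, for an edge c – e
--    of D₂ leaving N(v₂), is the path to glue; finite choice concludes.

open import Defs
open import Data.Nat using (ℕ; suc)
import Data.Nat as ℕ
open import Data.Bool using (Bool; true; false)
open import Data.Bool.Properties using (¬-not)
import Data.Bool as Bool
open import Data.Fin using (Fin; zero; suc; toℕ)
import Data.Fin as Fin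
open import Data.Fin.Subset using (Subset; _∈_)
open import Data.Fin.Subset.Properties using (_∈?_)
open import Data.Fin.Properties using (any?; all?; ¬∀⟶∃¬)
open import Data.Product using (Σ; ∃-syntax; _×_; _,_; curry)
open import Data.Sum using (_⊎_; inj₁; inj₂)
import Data.Sum as Sum
open import Data.Empty using (⊥; ⊥-elim)
open import Relation.Nullary using (¬_; Dec; does; yes; no)
open import Relation.Nullary.Decidable
  using (_×-dec_; _⊎-dec_; _→-dec_; ¬?; toWitness; dec-true; decidable-stable)
open import Relation.Binary.PropositionalEquality
  using (_≡_; trans; cong; subst) renaming (sym to ≡-sym)

eitherAllSucceed : ∀ {n} {C₁ S₁ C₂ S₂ : Fin n → Set} →
  (∀ x → Dec (C₁ x)) → (∀ x → Dec (S₁ x)) → (∀ y → Dec (S₂ y)) →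
  (∀ x y → C₁ x → ¬ S₁ x → C₂ y → ¬ S₂ y → ⊥) →
  (∀ x → C₁ x → S₁ x) ⊎ (∀ y → C₂ y → S₂ y)
eitherAllSucceed {n} C₁? S₁? S₂? exclusive with all? (λ x → C₁? x →-dec S₁? x)
... | yes all₁ = inj₁ all₁
... | no ¬all₁ with ¬∀⟶∃¬ n _ (λ x → C₁? x →-dec S₁? x) ¬all₁
...   | x , fails = inj₂ λ y c₂ → decidable-stable (S₂? y) λ ¬s₂ →
  fails λ c₁ → decidable-stable (S₁? x) λ ¬s₁ → exclusive x y c₁ ¬s₁ c₂ ¬s₂

consecutive? : (i j : Fin 6) → Dec (suc (toℕ i) ≡ toℕ j ⊎ suc (toℕ j) ≡ toℕ i)
consecutive? i j = (suc (toℕ i) ℕ.≟ toℕ j) ⊎-dec (suc (toℕ j) ℕ.≟ toℕ i)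

pathAdj : Fin 6 → Fin 6 → Bool
pathAdj i j = does (consecutive? i j)

rowsDistinct : ∀ i j → (∀ k → pathAdj i k ≡ pathAdj j k) → i ≡ j
rowsDistinct = toWitness {a? = all? λ i → all? λ j →
  (all? λ k → pathAdj i k Bool.≟ pathAdj j k) →-dec (i Fin.≟ j)} _

does⇒ : ∀ {A : Set} (a? : Dec A) → does a? ≡ true → A
does⇒ (yes a) _ = a

pattern f₀ = zero
pattern f₁ = suc f₀
pattern f₂ = suc f₁
pattern f₃ = suc f₂
pattern f₄ = suc f₃
pattern f₅ = suc f₄

module _ {n : ℕ} (G : Graph n) where

  Adj-sym : ∀ {u v} → Adj G u v → Adj G v u
  Adj-sym {u} {v} uv = trans (sym G v u) uv

  ¬Adj-sym : ∀ {u v} → ¬ Adj G u v → ¬ Adj G v u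
  ¬Adj-sym ¬uv vu = ¬uv (Adj-sym vu)

  adj? : ∀ u v → Dec (Adj G u v)
  adj? u v = adj G u v Bool.≟ true

  ¬Adj⇒false : ∀ {u v} → ¬ Adj G u v → adj G u v ≡ false
  ¬Adj⇒false = ¬-not

  -- A map from Fin 6 whose adjacency matrix is that of P₆ is an induced P₆;
  -- it is injective because distinct path vertices have distinct rows.
  pathMatrix⇒InducedP6 : (p : Fin 6 → Fin n) →
    (∀ i j → adj G (p i) (p j) ≡ pathAdj i j) → IsInducedP6 G p
  pathMatrix⇒InducedP6 p matches =
      (λ {i} {j} pi≡pj → rowsDistinct i j λ k →
         trans (≡-sym (matches i k)) (trans (cong (λ x → adj G x (p k)) pi≡pj) (matches j k)))
    , λ i j → (λ ij → does⇒ (consecutive? i j) (trans (≡-sym (matches i j)) ij))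
            , (λ c → trans (matches i j) (dec-true (consecutive? i j) c))

  inducedP6 : (x₀ x₁ x₂ x₃ x₄ x₅ : Fin n) →
    Adj G x₀ x₁ → Adj G x₁ x₂ → Adj G x₂ x₃ → Adj G x₃ x₄ → Adj G x₄ x₅ →
    ¬ Adj G x₀ x₂ → ¬ Adj G x₀ x₃ → ¬ Adj G x₀ x₄ → ¬ Adj G x₀ x₅ →
    ¬ Adj G x₁ x₃ → ¬ Adj G x₁ x₄ → ¬ Adj G x₁ x₅ →
    ¬ Adj G x₂ x₄ → ¬ Adj G x₂ x₅ → ¬ Adj G x₃ x₅ →
    Σ (Fin 6 → Fin n) (IsInducedP6 G)
  inducedP6 x₀ x₁ x₂ x₃ x₄ x₅ e₀₁ e₁₂ e₂₃ e₃₄ e₄₅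
            n₀₂ n₀₃ n₀₄ n₀₅ n₁₃ n₁₄ n₁₅ n₂₄ n₂₅ n₃₅ =
    p , pathMatrix⇒InducedP6 p matrix
    where
    p : Fin 6 → Fin n
    p f₀ = x₀
    p f₁ = x₁
    p f₂ = x₂
    p f₃ = x₃
    p f₄ = x₄
    p f₅ = x₅

    flip : ∀ {i j b} → adj G (p i) (p j) ≡ b → adj G (p j) (p i) ≡ b
    flip {i} {j} e = trans (sym G (p j) (p i)) e

    matrix : ∀ i j → adj G (p i) (p j) ≡ pathAdj i j
    matrix f₀ f₀ = irrefl G x₀
    matrix f₀ f₁ = e₀₁
    matrix f₀ f₂ = ¬Adj⇒false n₀₂
    matrix f₀ f₃ = ¬Adj⇒false n₀₃
    matrix f₀ f₄ = ¬Adj⇒false n₀₄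
    matrix f₀ f₅ = ¬Adj⇒false n₀₅
    matrix f₁ f₁ = irrefl G x₁
    matrix f₁ f₂ = e₁₂
    matrix f₁ f₃ = ¬Adj⇒false n₁₃
    matrix f₁ f₄ = ¬Adj⇒false n₁₄
    matrix f₁ f₅ = ¬Adj⇒false n₁₅
    matrix f₂ f₂ = irrefl G x₂
    matrix f₂ f₃ = e₂₃
    matrix f₂ f₄ = ¬Adj⇒false n₂₄
    matrix f₂ f₅ = ¬Adj⇒false n₂₅
    matrix f₃ f₃ = irrefl G x₃
    matrix f₃ f₄ = e₃₄
    matrix f₃ f₅ = ¬Adj⇒false n₃₅
    matrix f₄ f₄ = irrefl G x₄
    matrix f₄ f₅ = e₄₅
    matrix f₅ f₅ = irrefl G x₅
    matrix f₁ f₀ = flip (matrix f₀ f₁)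
    matrix f₂ f₀ = flip (matrix f₀ f₂)
    matrix f₂ f₁ = flip (matrix f₁ f₂)
    matrix f₃ f₀ = flip (matrix f₀ f₃)
    matrix f₃ f₁ = flip (matrix f₁ f₃)
    matrix f₃ f₂ = flip (matrix f₂ f₃)
    matrix f₄ f₀ = flip (matrix f₀ f₄)
    matrix f₄ f₁ = flip (matrix f₁ f₄)
    matrix f₄ f₂ = flip (matrix f₂ f₄)
    matrix f₄ f₃ = flip (matrix f₃ f₄)
    matrix f₅ f₀ = flip (matrix f₀ f₅)
    matrix f₅ f₁ = flip (matrix f₁ f₅)
    matrix f₅ f₂ = flip (matrix f₂ f₅)
    matrix f₅ f₃ = flip (matrix f₃ f₅)
    matrix f₅ f₄ = flip (matrix f₄ f₅)

  record InducedP4 (x₀ x₁ x₂ x₃ : Fin n) : Set where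
    constructor inducedP4
    field
      e₀₁ : Adj G x₀ x₁
      e₁₂ : Adj G x₁ x₂
      e₂₃ : Adj G x₂ x₃
      n₀₂ : ¬ Adj G x₀ x₂
      n₀₃ : ¬ Adj G x₀ x₃
      n₁₃ : ¬ Adj G x₁ x₃

  AwayFrom : Subset n → Fin n → Set
  AwayFrom X y = ∀ x → x ∈ X → ¬ Adj G x y

  gluedP6 : ∀ {X v a b y₁ y₂ y₃} → a ∈ X → b ∈ X →
    Adj G v a → Adj G a b → ¬ Adj G v b → InducedP4 v y₁ y₂ y₃ →
    AwayFrom X y₁ → AwayFrom X y₂ → AwayFrom X y₃ →
    Σ (Fin 6 → Fin n) (IsInducedP6 G)
  gluedP6 {v = v} {a} {b} {y₁} {y₂} {y₃} a∈X b∈X va ab ¬vb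
          (inducedP4 e₀₁ e₁₂ e₂₃ n₀₂ n₀₃ n₁₃) away₁ away₂ away₃ =
    inducedP6 b a v y₁ y₂ y₃ (Adj-sym ab) (Adj-sym va) e₀₁ e₁₂ e₂₃
      (¬Adj-sym ¬vb) (away₁ b b∈X) (away₂ b b∈X) (away₃ b b∈X)
      (away₁ a a∈X) (away₂ a a∈X) (away₃ a a∈X) n₀₂ n₀₃ n₁₃

  Connected : Subset n → Set
  Connected S = ∀ x y → x ∈ S → y ∈ S → WalkIn G S x y

  walkStart : ∀ {S x z} → WalkIn G S x z → x ∈ S
  walkStart (here x∈S)     = x∈S
  walkStart (step x∈S _ _) = x∈S

  exitEdge : ∀ {S} (P : Fin n → Set) → (∀ z → Dec (P z)) → ∀ {x y} →
    WalkIn G S x y → P x → ¬ P y →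
    ∃[ u ] ∃[ w ] (u ∈ S × w ∈ S × Adj G u w × P u × ¬ P w)
  exitEdge P P? (here _) Px ¬Py = ⊥-elim (¬Py Px)
  exitEdge P P? (step {x} {y} x∈S xy walk) Px ¬Pz with P? y
  ... | yes Py = exitEdge P P? walk Py ¬Pz
  ... | no ¬Py = x , y , x∈S , walkStart walk , xy , Px , ¬Py

  incomplete⇒edge : ∀ {S v x} → Connected S →
    x ∈ S → Adj G v x → ¬ CompleteTo G v S →
    ∃[ a ] ∃[ b ] (a ∈ S × b ∈ S × Adj G a b × Adj G v a × ¬ Adj G v b)
  incomplete⇒edge {S} {v} {x} connected x∈S vx incomplete
    with ¬∀⟶∃¬ n (λ y → y ∈ S → Adj G v y) (λ y → (y ∈? S) →-dec adj? v y) incomplete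
  ... | y , ¬vy with y ∈? S
  ...   | no y∉S  = ⊥-elim (¬vy λ y∈S → ⊥-elim (y∉S y∈S))
  ...   | yes y∈S = exitEdge (Adj G v) (adj? v) (connected x y x∈S y∈S) vx (λ vy → ¬vy λ _ → vy)

  shortConnection : ∀ {S v₁ v₂ s t} → Connected S →
    ¬ Adj G v₁ v₂ → s ∈ S → t ∈ S → Adj G v₁ s → Adj G v₂ t →
      (∃[ d ] (d ∈ S × Adj G v₁ d × Adj G d v₂))
    ⊎ (∃[ d₁ ] ∃[ d₂ ] (d₁ ∈ S × d₂ ∈ S × InducedP4 v₁ d₁ d₂ v₂))
    ⊎ (∃[ d₁ ] ∃[ d₂ ] ∃[ d₃ ] (d₁ ∈ S × d₂ ∈ S × d₃ ∈ S × InducedP4 v₁ d₁ d₂ d₃))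
  shortConnection {S} {v₁} {v₂} {s} {t} connected ¬v₁v₂ s∈S t∈S v₁s v₂t
    with any? (λ d → (d ∈? S) ×-dec adj? v₁ d ×-dec adj? d v₂)
  ... | yes common = inj₁ common
  ... | no ¬common
    with any? (λ d₁ → any? λ d₂ →
           (d₁ ∈? S) ×-dec (d₂ ∈? S) ×-dec adj? v₁ d₁ ×-dec adj? d₁ d₂ ×-dec adj? d₂ v₂)
  ...   | yes (d₁ , d₂ , d₁∈S , d₂∈S , v₁d₁ , d₁d₂ , d₂v₂) =
    inj₂ (inj₁ (d₁ , d₂ , d₁∈S , d₂∈S , inducedP4 v₁d₁ d₁d₂ d₂v₂
      (λ v₁d₂ → ¬common (d₂ , d₂∈S , v₁d₂ , d₂v₂)) ¬v₁v₂
      (λ d₁v₂ → ¬common (d₁ , d₁∈S , v₁d₁ , d₁v₂))))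
  ...   | no ¬path =
    inj₂ (inj₂ (leaveNear (exitEdge Near near? (connected s t s∈S t∈S) (inj₁ v₁s) t-far)))
    where
    Near : Fin n → Set
    Near z = Adj G v₁ z ⊎ ∃[ d ] (d ∈ S × Adj G v₁ d × Adj G d z)

    near? : ∀ z → Dec (Near z)
    near? z = adj? v₁ z ⊎-dec any? λ d → (d ∈? S) ×-dec adj? v₁ d ×-dec adj? d z

    t-far : ¬ Near t
    t-far (inj₁ v₁t)                = ¬common (t , t∈S , v₁t , Adj-sym v₂t)
    t-far (inj₂ (d , d∈S , v₁d , dt)) = ¬path (d , t , d∈S , t∈S , v₁d , dt , Adj-sym v₂t)

    -- the edge u – w leaving the near vertices extends v₁ – d – u to a P₄
    leaveNear : ∃[ u ] ∃[ w ] (u ∈ S × w ∈ S × Adj G u w × Near u × ¬ Near w) →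
      ∃[ d₁ ] ∃[ d₂ ] ∃[ d₃ ] (d₁ ∈ S × d₂ ∈ S × d₃ ∈ S × InducedP4 v₁ d₁ d₂ d₃)
    leaveNear (u , w , u∈S , w∈S , uw , inj₁ v₁u , w-far) =
      ⊥-elim (w-far (inj₂ (u , u∈S , v₁u , uw)))
    leaveNear (u , w , u∈S , w∈S , uw , inj₂ (d , d∈S , v₁d , du) , w-far) with adj? v₁ u
    ... | yes v₁u = ⊥-elim (w-far (inj₂ (u , u∈S , v₁u , uw)))
    ... | no ¬v₁u = d , u , w , d∈S , u∈S , w∈S ,
      inducedP4 v₁d du uw ¬v₁u (λ v₁w → w-far (inj₁ v₁w)) (λ dw → w-far (inj₂ (d , d∈S , v₁d , dw)))

  inN? : ∀ D v → Dec (InN G D v)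
  inN? D v = ¬? (v ∈? D) ×-dec any? λ x → (x ∈? D) ×-dec adj? v x

  completeTo? : ∀ v X → Dec (CompleteTo G v X)
  completeTo? v X = all? λ x → (x ∈? X) →-dec adj? v x

  module _ (Ω : Subset n) where

    Component : Subset n → Set
    Component = IsComponentOf G Ω

    Private : Subset n → Subset n → Fin n → Set
    Private D D' v = InN G D v × ¬ InN G D' v

    private? : ∀ D D' v → Dec (Private D D' v)
    private? D D' v = inN? D v ×-dec ¬? (inN? D' v)

    -- N(D) ⊆ Ω: a neighbour outside Ω would belong to D by maximality.
    neighbour∈Ω : ∀ {D v} → Component D → InN G D v → v ∈ Ω
    neighbour∈Ω (_ , _ , _ , maximal) (v∉D , x , x∈D , vx) with _ ∈? Ω
    ... | yes v∈Ω = v∈Ω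
    ... | no v∉Ω  = ⊥-elim (v∉D (maximal x _ x∈D (Adj-sym vx) v∉Ω))

    nonNeighbour⇒away : ∀ {D v} → Component D → v ∈ Ω → ¬ InN G D v → AwayFrom D v
    nonNeighbour⇒away (_ , disjoint , _ , _) v∈Ω ¬vD x x∈D xv =
      ¬vD ((λ v∈D → disjoint _ v∈D v∈Ω) , x , x∈D , Adj-sym xv)

    walkStaysIn : ∀ {D D' x z} → Component D → Component D' →
      WalkIn G D x z → x ∈ D' → z ∈ D'
    walkStaysIn cD cD' (here _) x∈D' = x∈D'
    walkStaysIn cD@(_ , disjoint , _ , _) cD'@(_ , _ , _ , maximal) (step {x} {y} _ xy walk) x∈D' =
      walkStaysIn cD cD' walk (maximal x y x∈D' xy (disjoint y (walkStart walk)))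

    -- If w ∈ N(Y) \ N(X), then Y has no neighbour in X: an edge between them
    -- would put all of Y, hence w's neighbour in Y, inside X.
    separated : ∀ {X Y w y} → Component X → Component Y → Private Y X w →
      y ∈ Y → AwayFrom X y
    separated {X} {Y} {w} {y} cX@(_ , disjointX , _ , maximalX) cY@(_ , disjointY , connectedY , _)
              (wY@(_ , t , t∈Y , wt) , ¬wX) y∈Y x x∈X xy =
      ¬wX ((λ w∈X → disjointX w w∈X (neighbour∈Ω cY wY)) , t , t∈X , wt)
      where
      t∈X : t ∈ X
      t∈X = walkStaysIn cY cX (connectedY y t y∈Y t∈Y)
              (maximalX x y x∈X xy (disjointY y y∈Y))

    module _ (p6free : P6Free G) where

      noP4Away : ∀ {X v y₁ y₂ y₃} → Component X → InN G X v → ¬ CompleteTo G v X →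
        InducedP4 v y₁ y₂ y₃ → AwayFrom X y₁ → AwayFrom X y₂ → AwayFrom X y₃ → ⊥
      noP4Away (_ , _ , connected , _) (_ , x , x∈X , vx) incomplete p4 away₁ away₂ away₃
        with incomplete⇒edge connected x∈X vx incomplete
      ... | a , b , a∈X , b∈X , ab , va , ¬vb =
        p6free (gluedP6 a∈X b∈X va ab ¬vb p4 away₁ away₂ away₃)

      -- Second claim: a private neighbour v₁ of D₁ with a non-adjacent private
      -- neighbour v₂ of D₂ is complete to D₁.  (PMC2) gives a component D with
      -- v₁, v₂ ∈ N(D); each way of connecting v₁ to v₂ through D yields an
      -- induced P₄ from v₁ away from D₁.
      privateComplete : ∀ {D₁ D₂ v₁ v₂} → IsPMC G Ω → Component D₁ → Component D₂ →
        Private D₁ D₂ v₁ → Private D₂ D₁ v₂ → ¬ Adj G v₁ v₂ → CompleteTo G v₁ D₁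
      privateComplete {D₁} {D₂} {v₁} {v₂} (_ , pmc₂) c₁ c₂
                      (v₁D₁ , ¬v₁D₂) p₂@(v₂D₂@(_ , c , c∈D₂ , v₂c) , ¬v₂D₁) ¬v₁v₂ =
        decidable-stable (completeTo? v₁ D₁) λ incomplete →
          connectThrough incomplete
            (pmc₂ v₁ v₂ (neighbour∈Ω c₁ v₁D₁) (neighbour∈Ω c₂ v₂D₂) v₁≢v₂ ¬v₁v₂)
        where
        v₁≢v₂ : v₁ ≡ v₂ → ⊥
        v₁≢v₂ v₁≡v₂ = ¬v₂D₁ (subst (InN G D₁) v₁≡v₂ v₁D₁)

        v₂-away : AwayFrom D₁ v₂
        v₂-away = nonNeighbour⇒away c₁ (neighbour∈Ω c₂ v₂D₂) ¬v₂D₁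

        D-away : ∀ {D d} → Component D → InN G D v₂ → d ∈ D → AwayFrom D₁ d
        D-away cD v₂D = separated c₁ cD (v₂D , ¬v₂D₁)

        connectThrough : ¬ CompleteTo G v₁ D₁ →
          ∃[ D ] (Component D × InN G D v₁ × InN G D v₂) → ⊥
        connectThrough incomplete
            (D , cD@(_ , _ , connected , _) , v₁D@(_ , s , s∈D , v₁s) , v₂D@(_ , t , t∈D , v₂t))
          with shortConnection connected ¬v₁v₂ s∈D t∈D v₁s v₂t
        ... | inj₁ (d , d∈D , v₁d , dv₂) =
          noP4Away c₁ v₁D₁ incomplete
            (inducedP4 v₁d dv₂ v₂c ¬v₁v₂
              (¬Adj-sym (nonNeighbour⇒away c₂ (neighbour∈Ω c₁ v₁D₁) ¬v₁D₂ c c∈D₂))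
              (¬Adj-sym (separated c₂ cD (v₁D , ¬v₁D₂) d∈D c c∈D₂)))
            (D-away cD v₂D d∈D) v₂-away (separated c₁ c₂ p₂ c∈D₂)
        ... | inj₂ (inj₁ (d₁ , d₂ , d₁∈D , d₂∈D , p4)) =
          noP4Away c₁ v₁D₁ incomplete p4 (D-away cD v₂D d₁∈D) (D-away cD v₂D d₂∈D) v₂-away
        ... | inj₂ (inj₂ (d₁ , d₂ , d₃ , d₁∈D , d₂∈D , d₃∈D , p4)) =
          noP4Away c₁ v₁D₁ incomplete p4
            (D-away cD v₂D d₁∈D) (D-away cD v₂D d₂∈D) (D-away cD v₂D d₃∈D)

      -- Private neighbours v₁ of D₁ and v₂ of D₂ cannot both be incomplete:
      -- by the second claim they are adjacent, and then v₁ – v₂ – c – e is an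
      -- induced P₄ away from D₁ for an edge c – e of D₂ leaving N(v₂).
      noTwoIncompletePrivates : ∀ {D₁ D₂ v₁ v₂} → IsPMC G Ω → Component D₁ → Component D₂ →
        Private D₁ D₂ v₁ → ¬ CompleteTo G v₁ D₁ →
        Private D₂ D₁ v₂ → ¬ CompleteTo G v₂ D₂ → ⊥
      noTwoIncompletePrivates {D₁} {D₂} {v₁} {v₂} pmc c₁ c₂@(_ , _ , connected₂ , _)
                              p₁@(v₁D₁ , ¬v₁D₂) incomplete₁ p₂@(v₂D₂@(_ , x , x∈D₂ , v₂x) , ¬v₂D₁) incomplete₂
        with adj? v₁ v₂ | incomplete⇒edge connected₂ x∈D₂ v₂x incomplete₂
      ... | no ¬v₁v₂ | _ = incomplete₁ (privateComplete pmc c₁ c₂ p₁ p₂ ¬v₁v₂)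
      ... | yes v₁v₂ | c , e , c∈D₂ , e∈D₂ , ce , v₂c , ¬v₂e =
        noP4Away c₁ v₁D₁ incomplete₁
          (inducedP4 v₁v₂ v₂c ce (¬Adj-sym (v₁-away c c∈D₂)) (¬Adj-sym (v₁-away e e∈D₂)) ¬v₂e)
          (nonNeighbour⇒away c₁ (neighbour∈Ω c₂ v₂D₂) ¬v₂D₁)
          (separated c₁ c₂ p₂ c∈D₂) (separated c₁ c₂ p₂ e∈D₂)
        where
        v₁-away : AwayFrom D₂ v₁
        v₁-away = nonNeighbour⇒away c₂ (neighbour∈Ω c₁ v₁D₁) ¬v₁D₂

lemma3p12 : (n : ℕ) (G : Graph n) → P6Free G →
    (Ω D₁ D₂ : Subset n) → IsPMC G Ω →
    IsComponentOf G Ω D₁ → IsComponentOf G Ω D₂ →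
    ((∀ v → InN G D₁ v → ¬ InN G D₂ v → CompleteTo G v D₁)
      ⊎ (∀ v → InN G D₂ v → ¬ InN G D₁ v → CompleteTo G v D₂))
    × (∀ v₁ v₂ → InN G D₁ v₁ → ¬ InN G D₂ v₁ → InN G D₂ v₂ → ¬ InN G D₁ v₂ →
         ¬ Adj G v₁ v₂ → CompleteTo G v₁ D₁ × CompleteTo G v₂ D₂)
lemma3p12 n G p6free Ω D₁ D₂ pmc c₁ c₂ = firstClaim , secondClaim
  where
  firstClaim : (∀ v → InN G D₁ v → ¬ InN G D₂ v → CompleteTo G v D₁)
             ⊎ (∀ v → InN G D₂ v → ¬ InN G D₁ v → CompleteTo G v D₂)
  firstClaim =
    Sum.map (λ all₁ v → curry (all₁ v)) (λ all₂ v → curry (all₂ v))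
      (eitherAllSucceed (private? G Ω D₁ D₂) (λ v → completeTo? G v D₁) (λ v → completeTo? G v D₂)
        λ v₁ v₂ p₁ incomplete₁ p₂ incomplete₂ →
          noTwoIncompletePrivates G Ω p6free pmc c₁ c₂ p₁ incomplete₁ p₂ incomplete₂)

  secondClaim : ∀ v₁ v₂ → InN G D₁ v₁ → ¬ InN G D₂ v₁ → InN G D₂ v₂ → ¬ InN G D₁ v₂ →
    ¬ Adj G v₁ v₂ → CompleteTo G v₁ D₁ × CompleteTo G v₂ D₂
  secondClaim v₁ v₂ v₁D₁ ¬v₁D₂ v₂D₂ ¬v₂D₁ ¬v₁v₂ =
      privateComplete G Ω p6free pmc c₁ c₂ (v₁D₁ , ¬v₁D₂) (v₂D₂ , ¬v₂D₁) ¬v₁v₂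
    , privateComplete G Ω p6free pmc c₂ c₁ (v₂D₂ , ¬v₂D₁) (v₁D₁ , ¬v₁D₂) (¬Adj-sym G ¬v₁v₂)
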